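{- Let $n\ge3$ and let $L_n$ be the $n\times n$ matrix indexed by $0,\ldots,n-1$ with $(0,0)$ entry $3$, $(i,i)$ entry $2$ for $1\le i\le n-1$, entry $-1$ in positions $(i,j)$ with $j\equiv i\pm1\pmod n$, and $0$ elsewhere. Then $nL_n^{ -1}$ is an integer matrix whose reduction modulo $n$ has columns $v_0,v_1,\ldots,v_{n-1}\in\mathbb{Z}_n^n$ with $v_1=(0,n-1,n-2,\ldots,2,1)^T$ and $v_k=kv_1$ in $\mathbb{Z}_n^n$ for each $0\le k\le n-1$.
   Context: $\mathbb{Z}_n$ denotes the integers modulo $n$. -}

module Defs where

open import Data.Nat as ℕ using (ℕ; zero; suc; NonZero)
open import Data.Nat.DivMod using (_%_)
open import Data.Integer using (ℤ; +_; -[1+_]; _+_; _*_; _-_)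
open import Data.Fin using (Fin; toℕ)
open import Data.Bool using (Bool; true; false; if_then_else_; _∨_)
open import Relation.Nullary.Decidable using (⌊_⌋)
open import Data.Fin.Properties using () renaming (_≟_ to _≟ᶠ_)

Matrix : ℕ → Set
Matrix n = Fin n → Fin n → ℤ

sumFin : ∀ {n} → (Fin n → ℤ) → ℤ
sumFin {zero}  f = + 0
sumFin {suc n} f = f Fin.zero + sumFin (λ k → f (Fin.suc k))

_⊗_ : ∀ {n} → Matrix n → Matrix n → Matrix n
(A ⊗ B) i j = sumFin (λ k → A i k * B k j)

scalarI : ∀ {n} → ℤ → Matrix n
scalarI c i j = if ⌊ i ≟ᶠ j ⌋ then c else + 0

-- j ≡ i + 1 (mod n)  or  j ≡ i - 1 (mod n)  (the latter written as i ≡ j + 1 (mod n))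
adjacent : (n : ℕ) .{{_ : NonZero n}} → Fin n → Fin n → Bool
adjacent n i j = ⌊ (suc (toℕ i)) % n ℕ.≟ toℕ j ⌋ ∨ ⌊ (suc (toℕ j)) % n ℕ.≟ toℕ i ⌋

Lmat : (n : ℕ) .{{_ : NonZero n}} → Matrix n
Lmat n i j =
  if ⌊ i ≟ᶠ j ⌋
    then (if ⌊ toℕ i ℕ.≟ 0 ⌋ then + 3 else + 2)
    else (if adjacent n i j then -[1+ 0 ] else + 0)

v₁ : (n : ℕ) → Fin n → ℤ
v₁ n i = if ⌊ toℕ i ℕ.≟ 0 ⌋ then + 0 else + (n ℕ.∸ toℕ i)

-- n·L_n⁻¹ is the symmetric matrix M with M a b = n(1 + min(a,b)) − ab. Row a of L_n takes the
-- second difference of a column of M along the cycle; as a function of a, min(a,b) is piecewise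
-- linear with a single kink at b and ab is linear, so the second difference is n at a = b and 0
-- elsewhere. The wrap-around from n − 1 to 0 is harmless because M 0 b = n is also the value the
-- formula takes at a = n, and in row 0 the extra 1 on the diagonal of L_n absorbs the jump there.
-- Symmetry of L_n and M gives M L_n = (L_n M)ᵀ = nI. Finally M a b ≡ −ab ≡ b(n − a) (mod n),
-- which is b times entry a of v₁ (for a = 0 both sides are multiples of n).
module Submission where

open import Defs
open import Data.Nat using (ℕ; NonZero; _≤_)
open import Data.Integer using (+_; _*_; _-_)
open import Data.Integer.Divisibility using (_∣_)
open import Data.Fin using (Fin; toℕ)
open import Data.Product using (Σ; _×_)
open import Relation.Binary.PropositionalEquality using (_≡_)

open import Algebra.Properties.CommutativeSemigroup using (interchange)
open import Data.Bool using (if_then_else_; _∨_)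
open import Data.Bool.Properties using (∨-comm)
open import Data.Empty using (⊥-elim)
open import Data.Fin using (zero; suc; fromℕ; fromℕ<; inject₁)
import Data.Fin.Properties as Finₚ
open import Data.Fin.Properties using (toℕ-injective; toℕ-fromℕ; toℕ-fromℕ<; toℕ-inject₁; toℕ<n; toℕ≤n; toℕ≤pred[n])
  renaming (_≟_ to _≟ᶠ_)
open import Data.Integer using (ℤ; _+_; -1ℤ)
open import Data.Integer.Properties
  using (+-identityˡ; +-identityʳ; *-comm; +-commutativeSemigroup; m-n≡m⊖n; ⊖-≥)
open import Data.Integer.Divisibility.Signed using (divides; ∣⇒∣ᵤ)
open import Data.Integer.Tactic.RingSolver using (solve-∀)
open import Data.Nat as ℕ using (zero; suc; _⊓_; _∸_)
open import Data.Nat.DivMod using (_%_; m%n<n; m<n⇒m%n≡m; n%n≡0)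
open import Data.Nat.Properties
  using (⊓-comm; ⊓-idem; m≤n⇒m⊓n≡m; m≥n⇒m⊓n≡n; ⊓-zeroʳ; <-cmp; n≤1+n; m≤n⇒m≤1+n; <⇒≤; 1+n≢n; m≤n⇒m<n∨m≡n; suc-injective; m≢1+n+m)
open import Data.Product using (_,_)
open import Data.Sum using (_⊎_; inj₁; inj₂)
open import Function using (_∘_; _⇔_; mk⇔; Equivalence)
open import Relation.Binary.Definitions using (tri<; tri≈; tri>)
open import Relation.Binary.PropositionalEquality using (refl; sym; trans; cong; cong₂; _≢_; module ≡-Reasoning)
open import Relation.Nullary using (¬_; Dec; yes; no)
open import Relation.Nullary.Decidable using (⌊_⌋; isYes≗does; does-⇔; ⌊⌋-map′)

open ≡-Reasoning

⌊⌋-⇔ : ∀ {a b} {A : Set a} {B : Set b} → A ⇔ B → (a? : Dec A) (b? : Dec B) → ⌊ a? ⌋ ≡ ⌊ b? ⌋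
⌊⌋-⇔ A⇔B a? b? = trans (isYes≗does a?) (trans (does-⇔ A⇔B a? b?) (sym (isYes≗does b?)))

if-∨-disjoint : ∀ {a b} {A : Set a} {B : Set b} (a? : Dec A) (b? : Dec B) (c : ℤ) → ¬ (A × B) →
  (if ⌊ a? ⌋ ∨ ⌊ b? ⌋ then c else + 0) ≡ (if ⌊ a? ⌋ then c else + 0) + (if ⌊ b? ⌋ then c else + 0)
if-∨-disjoint (yes a) (yes b) c ¬a×b = ⊥-elim (¬a×b (a , b))
if-∨-disjoint (yes _) (no _)  c _    = sym (+-identityʳ c)
if-∨-disjoint (no _)  (yes _) c _    = sym (+-identityˡ c)
if-∨-disjoint (no _)  (no _)  c _    = refl

pos-∸ : ∀ {m n} → n ≤ m → + (m ∸ n) ≡ + m - + n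
pos-∸ {m} {n} n≤m = sym (trans (m-n≡m⊖n m n) (⊖-≥ n≤m))

sumFin-cong : ∀ {n} {f g : Fin n → ℤ} → (∀ k → f k ≡ g k) → sumFin f ≡ sumFin g
sumFin-cong {zero}  f≗g = refl
sumFin-cong {suc n} f≗g = cong₂ _+_ (f≗g zero) (sumFin-cong (f≗g ∘ suc))

sumFin-+ : ∀ {n} (f g : Fin n → ℤ) → sumFin (λ k → f k + g k) ≡ sumFin f + sumFin g
sumFin-+ {zero}  f g = refl
sumFin-+ {suc n} f g = trans (cong (_+_ (f zero + g zero)) (sumFin-+ (f ∘ suc) (g ∘ suc)))
  (interchange +-commutativeSemigroup (f zero) (g zero) (sumFin (f ∘ suc)) (sumFin (g ∘ suc)))

sumFin-zero : ∀ {n} → sumFin {n} (λ _ → + 0) ≡ + 0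
sumFin-zero {zero}  = refl
sumFin-zero {suc n} = trans (+-identityˡ _) (sumFin-zero {n})

scalarI-suc : ∀ {n} c (a k : Fin n) → scalarI c (suc a) (suc k) ≡ scalarI c a k
scalarI-suc c a k = cong (if_then c else + 0) (⌊⌋-map′ (cong suc) Finₚ.suc-injective (a ≟ᶠ k))

scalarI-≢ : ∀ {n} c {a b : Fin n} → a ≢ b → scalarI c a b ≡ + 0
scalarI-≢ c {a} {b} a≢b with a ≟ᶠ b
... | yes a≡b = ⊥-elim (a≢b a≡b)
... | no _    = refl

scalarI-sym : ∀ {n} c (a b : Fin n) → scalarI c a b ≡ scalarI c b a
scalarI-sym c a b = cong (if_then c else + 0) (⌊⌋-⇔ (mk⇔ sym sym) (a ≟ᶠ b) (b ≟ᶠ a))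

scalarI-toℕ : ∀ {n} c (a b : Fin n) → scalarI c a b ≡ (if ⌊ toℕ a ℕ.≟ toℕ b ⌋ then c else + 0)
scalarI-toℕ c a b = cong (if_then c else + 0) (⌊⌋-⇔ (mk⇔ (cong toℕ) toℕ-injective) (a ≟ᶠ b) (toℕ a ℕ.≟ toℕ b))

sumFin-scalarI : ∀ {n} c (a : Fin n) (g : Fin n → ℤ) → sumFin (λ k → scalarI c a k * g k) ≡ c * g a
sumFin-scalarI {suc n} c zero g = trans (cong (_+_ (c * g zero)) (sumFin-zero {n})) (+-identityʳ (c * g zero))
sumFin-scalarI c (suc a) g = begin
  + 0 + sumFin (λ k → scalarI c (suc a) (suc k) * g (suc k)) ≡⟨ +-identityˡ _ ⟩
  sumFin (λ k → scalarI c (suc a) (suc k) * g (suc k))       ≡⟨ sumFin-cong (λ k → cong (_* g (suc k)) (scalarI-suc c a k)) ⟩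
  sumFin (λ k → scalarI c a k * g (suc k))                   ≡⟨ sumFin-scalarI c a (g ∘ suc) ⟩
  c * g (suc a)                                               ∎

Symmetric : ∀ {n} → Matrix n → Set
Symmetric A = ∀ i j → A i j ≡ A j i

⊗-transpose : ∀ {n} {A B : Matrix n} → Symmetric A → Symmetric B → ∀ i j → (A ⊗ B) i j ≡ (B ⊗ A) j i
⊗-transpose {A = A} {B} A-sym B-sym i j =
  sumFin-cong (λ k → trans (*-comm (A i k) (B k j)) (cong₂ _*_ (B-sym k j) (A-sym i k)))

-- Equal to n + min(a,b)·(n − max(a,b)); this form makes the congruence M a b ≡ −ab (mod n) evident.
green : ℕ → ℕ → ℕ → ℤ
green n a b = + n * (+ 1 + + (a ⊓ b)) - + a * + b

green-sym : ∀ n a b → green n a b ≡ green n b a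
green-sym n a b = cong₂ (λ c d → + n * (+ 1 + + c) - d) (⊓-comm a b) (*-comm (+ a) (+ b))

green-0ˡ : ∀ n b → green n 0 b ≡ + n
green-0ˡ n b = identity (+ n) (+ b)
  where
  identity : ∀ N B → N * (+ 1 + + 0) - + 0 * B ≡ N
  identity = solve-∀

green-nˡ : ∀ n b → b ≤ n → green n n b ≡ + n
green-nˡ n b b≤n rewrite m≥n⇒m⊓n≡n b≤n = identity (+ n) (+ b)
  where
  identity : ∀ N B → N * (+ 1 + B) - N * B ≡ N
  identity = solve-∀

green-interior : ∀ n a b →
  + 2 * green n (suc a) b - (green n (suc (suc a)) b + green n a b) ≡ (if ⌊ suc a ℕ.≟ b ⌋ then + n else + 0)
green-interior n a b with suc a ℕ.≟ b
... | yes refl rewrite m≤n⇒m⊓n≡m (n≤1+n a) | ⊓-idem (suc a) | m≥n⇒m⊓n≡n (n≤1+n (suc a)) = diagonal (+ n) (+ a)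
  where
  diagonal : ∀ N A → + 2 * (N * (+ 1 + (+ 1 + A)) - (+ 1 + A) * (+ 1 + A))
                     - ((N * (+ 1 + (+ 1 + A)) - (+ 2 + A) * (+ 1 + A)) + (N * (+ 1 + A) - A * (+ 1 + A))) ≡ N
  diagonal = solve-∀
... | no a+1≢b with <-cmp (suc a) b
...   | tri≈ _ a+1≡b _ = ⊥-elim (a+1≢b a+1≡b)
...   | tri< a+1<b _ _
  rewrite m≤n⇒m⊓n≡m (<⇒≤ a+1<b) | m≤n⇒m⊓n≡m a+1<b | m≤n⇒m⊓n≡m (<⇒≤ (<⇒≤ a+1<b)) = below (+ n) (+ a) (+ b)
  where
  below : ∀ N A B → + 2 * (N * (+ 1 + (+ 1 + A)) - (+ 1 + A) * B)
                    - ((N * (+ 1 + (+ 2 + A)) - (+ 2 + A) * B) + (N * (+ 1 + A) - A * B)) ≡ + 0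
  below = solve-∀
...   | tri> _ _ b<a+1
  rewrite m≥n⇒m⊓n≡n (<⇒≤ b<a+1) | m≥n⇒m⊓n≡n (m≤n⇒m≤1+n (<⇒≤ b<a+1)) | m≥n⇒m⊓n≡n (ℕ.s≤s⁻¹ b<a+1) = above (+ n) (+ a) (+ b)
  where
  above : ∀ N A B → + 2 * (N * (+ 1 + B) - (+ 1 + A) * B)
                    - ((N * (+ 1 + B) - (+ 2 + A) * B) + (N * (+ 1 + B) - A * B)) ≡ + 0
  above = solve-∀

green-corner : ∀ k b → b ≤ k →
  + 3 * green (suc k) 0 b - (green (suc k) 1 b + green (suc k) k b) ≡ (if ⌊ 0 ℕ.≟ b ⌋ then + suc k else + 0)
green-corner k zero    _   rewrite ⊓-zeroʳ k = diagonal (+ suc k) (+ k)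
  where
  diagonal : ∀ N K → + 3 * (N * (+ 1 + + 0) - + 0 * + 0)
                     - ((N * (+ 1 + + 0) - + 1 * + 0) + (N * (+ 1 + + 0) - K * + 0)) ≡ N
  diagonal = solve-∀
green-corner k (suc b) b<k rewrite m≥n⇒m⊓n≡n b<k = off-diagonal (+ k) (+ b)
  where
  off-diagonal : ∀ K B → + 3 * ((+ 1 + K) * (+ 1 + + 0) - + 0 * (+ 1 + B))
                         - (((+ 1 + K) * (+ 1 + + 1) - + 1 * (+ 1 + B)) + ((+ 1 + K) * (+ 1 + (+ 1 + B)) - K * (+ 1 + B))) ≡ + 0
  off-diagonal = solve-∀

green-≡-mod : ∀ n a b → green n a b - + b * (+ n - + a) ≡ (+ 1 + + (a ⊓ b) - + b) * + n
green-≡-mod n a b = identity (+ n) (+ a) (+ b) (+ (a ⊓ b))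
  where
  identity : ∀ N A B M → N * (+ 1 + M) - A * B - B * (N - A) ≡ (+ 1 + M - B) * N
  identity = solve-∀

module Cycle (m : ℕ) where

  n : ℕ
  n = suc (suc (suc m))

  next : Fin n → Fin n
  next i = fromℕ< (m%n<n (suc (toℕ i)) n)

  prev : Fin n → Fin n
  prev zero    = fromℕ (suc (suc m))
  prev (suc i) = inject₁ i

  toℕ-next : ∀ i → toℕ (next i) ≡ suc (toℕ i) % n
  toℕ-next i = toℕ-fromℕ< (m%n<n (suc (toℕ i)) n)

  toℕ-next-cases : ∀ i → (toℕ (next i) ≡ suc (toℕ i)) ⊎ (toℕ (next i) ≡ 0 × suc (toℕ i) ≡ n)
  toℕ-next-cases i with m≤n⇒m<n∨m≡n (toℕ<n i)
  ... | inj₁ i+1<n = inj₁ (trans (toℕ-next i) (m<n⇒m%n≡m i+1<n))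
  ... | inj₂ i+1≡n = inj₂ (trans (toℕ-next i) (trans (cong (_% n) i+1≡n) (n%n≡0 n)) , i+1≡n)

  next-prev : ∀ i → next (prev i) ≡ i
  next-prev zero = toℕ-injective (begin
    toℕ (next (prev zero))        ≡⟨ toℕ-next (prev zero) ⟩
    suc (toℕ (prev zero)) % n     ≡⟨ cong (λ a → suc a % n) (toℕ-fromℕ (suc (suc m))) ⟩
    n % n                         ≡⟨ n%n≡0 n ⟩
    0                             ∎)
  next-prev (suc i) = toℕ-injective (begin
    toℕ (next (inject₁ i))        ≡⟨ toℕ-next (inject₁ i) ⟩
    suc (toℕ (inject₁ i)) % n     ≡⟨ cong (λ a → suc a % n) (toℕ-inject₁ i) ⟩
    suc (toℕ i) % n               ≡⟨ m<n⇒m%n≡m (toℕ<n (suc i)) ⟩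
    suc (toℕ i)                   ∎)

  prev-next : ∀ i → prev (next i) ≡ i
  prev-next i with next i | toℕ-next-cases i
  ... | zero  | inj₂ (_ , i+1≡n) = toℕ-injective (trans (toℕ-fromℕ (suc (suc m))) (suc-injective (sym i+1≡n)))
  ... | suc j | inj₁ j+1≡i+1     = toℕ-injective (trans (toℕ-inject₁ j) (suc-injective j+1≡i+1))

  next≢id : ∀ i → next i ≢ i
  next≢id i next≡i with toℕ-next-cases i
  ... | inj₁ next≡i+1 = 1+n≢n (trans (sym next≡i+1) (cong toℕ next≡i))
  ... | inj₂ (next≡0 , i+1≡n) with trans (cong suc (trans (sym next≡0) (cong toℕ next≡i))) i+1≡n
  ...   | ()

  prev≢id : ∀ i → prev i ≢ i
  prev≢id i prev≡i = next≢id i (trans (cong next (sym prev≡i)) (next-prev i))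

  -- The only place where n ≥ 3 is used: for n = 2 the two neighbours coincide.
  next≢prev : ∀ i → next i ≢ prev i
  next≢prev zero next≡prev with trans (cong toℕ next≡prev) (toℕ-fromℕ (suc (suc m)))
  ... | ()
  next≢prev (suc i) next≡prev with toℕ-next-cases (suc i) | trans (cong toℕ next≡prev) (toℕ-inject₁ i)
  ... | inj₁ next≡i+2         | next≡i = m≢1+n+m (toℕ i) {1} (trans (sym next≡i) next≡i+2)
  ... | inj₂ (next≡0 , i+2≡n) | next≡i with trans (cong (λ a → suc (suc a)) (trans (sym next≡0) next≡i)) i+2≡n
  ...   | ()

  next≡-⇔ : ∀ i k → (suc (toℕ i) % n ≡ toℕ k) ⇔ (next i ≡ k)
  next≡-⇔ i k = mk⇔ (λ e → toℕ-injective (trans (toℕ-next i) e)) (λ e → trans (sym (toℕ-next i)) (cong toℕ e))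

  prev≡-⇔ : ∀ i k → (suc (toℕ k) % n ≡ toℕ i) ⇔ (prev i ≡ k)
  prev≡-⇔ i k = mk⇔
    (λ e → trans (cong prev (sym (Equivalence.to (next≡-⇔ k i) e))) (prev-next k))
    (λ e → Equivalence.from (next≡-⇔ k i) (trans (cong next (sym e)) (next-prev i)))

  adjacent-next-prev : ∀ i k → adjacent n i k ≡ ⌊ next i ≟ᶠ k ⌋ ∨ ⌊ prev i ≟ᶠ k ⌋
  adjacent-next-prev i k = cong₂ _∨_
    (⌊⌋-⇔ (next≡-⇔ i k) (suc (toℕ i) % n ℕ.≟ toℕ k) (next i ≟ᶠ k))
    (⌊⌋-⇔ (prev≡-⇔ i k) (suc (toℕ k) % n ℕ.≟ toℕ i) (prev i ≟ᶠ k))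

  diagonal : Fin n → ℤ
  diagonal i = if ⌊ toℕ i ℕ.≟ 0 ⌋ then + 3 else + 2

  Lmat-neighbours : ∀ i k → Lmat n i k ≡ scalarI (diagonal i) i k + (scalarI -1ℤ (next i) k + scalarI -1ℤ (prev i) k)
  Lmat-neighbours i k with i ≟ᶠ k
  ... | yes refl = sym (begin
    diagonal i + (scalarI -1ℤ (next i) i + scalarI -1ℤ (prev i) i)
      ≡⟨ cong₂ (λ x y → diagonal i + (x + y)) (scalarI-≢ -1ℤ (next≢id i)) (scalarI-≢ -1ℤ (prev≢id i)) ⟩
    diagonal i + + 0
      ≡⟨ +-identityʳ (diagonal i) ⟩
    diagonal i ∎)
  ... | no _ = begin
    (if adjacent n i k then -1ℤ else + 0)
      ≡⟨ cong (if_then -1ℤ else + 0) (adjacent-next-prev i k) ⟩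
    (if ⌊ next i ≟ᶠ k ⌋ ∨ ⌊ prev i ≟ᶠ k ⌋ then -1ℤ else + 0)
      ≡⟨ if-∨-disjoint (next i ≟ᶠ k) (prev i ≟ᶠ k) -1ℤ (λ (next≡k , prev≡k) → next≢prev i (trans next≡k (sym prev≡k))) ⟩
    scalarI -1ℤ (next i) k + scalarI -1ℤ (prev i) k
      ≡⟨ +-identityˡ _ ⟨
    + 0 + (scalarI -1ℤ (next i) k + scalarI -1ℤ (prev i) k) ∎

  Lmat-row : ∀ i (g : Fin n → ℤ) → sumFin (λ k → Lmat n i k * g k) ≡ diagonal i * g i - (g (next i) + g (prev i))
  Lmat-row i g = begin
    sumFin (λ k → Lmat n i k * g k)
      ≡⟨ sumFin-cong (λ k → trans (cong (_* g k) (Lmat-neighbours i k)) (distrib (δ k) (δ⁺ k) (δ⁻ k) (g k))) ⟩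
    sumFin (λ k → δ k * g k + (δ⁺ k * g k + δ⁻ k * g k))
      ≡⟨ trans (sumFin-+ (λ k → δ k * g k) (λ k → δ⁺ k * g k + δ⁻ k * g k))
           (cong (_+_ (sumFin (λ k → δ k * g k))) (sumFin-+ (λ k → δ⁺ k * g k) (λ k → δ⁻ k * g k))) ⟩
    sumFin (λ k → δ k * g k) + (sumFin (λ k → δ⁺ k * g k) + sumFin (λ k → δ⁻ k * g k))
      ≡⟨ cong₂ _+_ (sumFin-scalarI _ i g) (cong₂ _+_ (sumFin-scalarI _ (next i) g) (sumFin-scalarI _ (prev i) g)) ⟩
    diagonal i * g i + (-1ℤ * g (next i) + -1ℤ * g (prev i))
      ≡⟨ negate (diagonal i * g i) (g (next i)) (g (prev i)) ⟩
    diagonal i * g i - (g (next i) + g (prev i)) ∎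
    where
    δ δ⁺ δ⁻ : Fin n → ℤ
    δ  = scalarI (diagonal i) i
    δ⁺ = scalarI -1ℤ (next i)
    δ⁻ = scalarI -1ℤ (prev i)
    distrib : ∀ x y z w → (x + (y + z)) * w ≡ x * w + (y * w + z * w)
    distrib = solve-∀
    negate : ∀ x y z → x + (-1ℤ * y + -1ℤ * z) ≡ x - (y + z)
    negate = solve-∀

  green-next : ∀ i b → b ≤ n → green n (toℕ (next i)) b ≡ green n (suc (toℕ i)) b
  green-next i b b≤n with toℕ-next-cases i
  ... | inj₁ next≡i+1 = cong (λ a → green n a b) next≡i+1
  ... | inj₂ (next≡0 , i+1≡n) = begin
    green n (toℕ (next i)) b   ≡⟨ cong (λ a → green n a b) next≡0 ⟩
    green n 0 b                ≡⟨ green-0ˡ n b ⟩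
    + n                        ≡⟨ green-nˡ n b b≤n ⟨
    green n n b                ≡⟨ cong (λ a → green n a b) i+1≡n ⟨
    green n (suc (toℕ i)) b    ∎

  scaledInverse : Matrix n
  scaledInverse i j = green n (toℕ i) (toℕ j)

  Lmat-column : ∀ i j →
    diagonal i * scaledInverse i j - (scaledInverse (next i) j + scaledInverse (prev i) j) ≡ scalarI (+ n) i j
  Lmat-column zero j = begin
    + 3 * G 0 - (G (toℕ (next zero)) + G (toℕ (prev zero)))
      ≡⟨ cong₂ (λ x y → + 3 * G 0 - (x + y)) (green-next zero (toℕ j) (toℕ≤n j)) (cong G (toℕ-fromℕ (suc (suc m)))) ⟩
    + 3 * G 0 - (G 1 + G (suc (suc m)))
      ≡⟨ green-corner (suc (suc m)) (toℕ j) (toℕ≤pred[n] j) ⟩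
    (if ⌊ 0 ℕ.≟ toℕ j ⌋ then + n else + 0)
      ≡⟨ scalarI-toℕ (+ n) zero j ⟨
    scalarI (+ n) zero j ∎
    where
    G : ℕ → ℤ
    G a = green n a (toℕ j)
  Lmat-column (suc i) j = begin
    + 2 * G (suc (toℕ i)) - (G (toℕ (next (suc i))) + G (toℕ (inject₁ i)))
      ≡⟨ cong₂ (λ x y → + 2 * G (suc (toℕ i)) - (x + y)) (green-next (suc i) (toℕ j) (toℕ≤n j)) (cong G (toℕ-inject₁ i)) ⟩
    + 2 * G (suc (toℕ i)) - (G (suc (suc (toℕ i))) + G (toℕ i))
      ≡⟨ green-interior n (toℕ i) (toℕ j) ⟩
    (if ⌊ suc (toℕ i) ℕ.≟ toℕ j ⌋ then + n else + 0)
      ≡⟨ scalarI-toℕ (+ n) (suc i) j ⟨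
    scalarI (+ n) (suc i) j ∎
    where
    G : ℕ → ℤ
    G a = green n a (toℕ j)

  Lmat-⊗-scaledInverse : ∀ i j → (Lmat n ⊗ scaledInverse) i j ≡ scalarI (+ n) i j
  Lmat-⊗-scaledInverse i j = trans (Lmat-row i (λ k → scaledInverse k j)) (Lmat-column i j)

  Lmat-sym : Symmetric (Lmat n)
  Lmat-sym i k with i ≟ᶠ k | k ≟ᶠ i
  ... | yes refl | yes _    = refl
  ... | yes refl | no k≢k   = ⊥-elim (k≢k refl)
  ... | no i≢k   | yes k≡i  = ⊥-elim (i≢k (sym k≡i))
  ... | no _     | no _     =
    cong (if_then -1ℤ else + 0) (∨-comm ⌊ suc (toℕ i) % n ℕ.≟ toℕ k ⌋ ⌊ suc (toℕ k) % n ℕ.≟ toℕ i ⌋)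

  scaledInverse-⊗-Lmat : ∀ i j → (scaledInverse ⊗ Lmat n) i j ≡ scalarI (+ n) i j
  scaledInverse-⊗-Lmat i j = begin
    (scaledInverse ⊗ Lmat n) i j  ≡⟨ ⊗-transpose (λ a b → green-sym n (toℕ a) (toℕ b)) Lmat-sym i j ⟩
    (Lmat n ⊗ scaledInverse) j i  ≡⟨ Lmat-⊗-scaledInverse j i ⟩
    scalarI (+ n) j i             ≡⟨ scalarI-sym (+ n) j i ⟩
    scalarI (+ n) i j             ∎

  scaledInverse-column : ∀ i k → + n ∣ scaledInverse i k - + toℕ k * v₁ n i
  scaledInverse-column zero    k = ∣⇒∣ᵤ {+ n} (divides (+ 1) (identity (+ n) (+ toℕ k)))
    where
    identity : ∀ N B → N * (+ 1 + + 0) - + 0 * B - B * + 0 ≡ + 1 * N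
    identity = solve-∀
  scaledInverse-column (suc i) k = ∣⇒∣ᵤ {+ n} (divides (+ 1 + + (a ⊓ b) - + b) (begin
    green n a b - + b * + (n ∸ a)    ≡⟨ cong (λ v → green n a b - + b * v) (pos-∸ (<⇒≤ (toℕ<n (suc i)))) ⟩
    green n a b - + b * (+ n - + a)  ≡⟨ green-≡-mod n a b ⟩
    (+ 1 + + (a ⊓ b) - + b) * + n    ∎))
    where
    a = suc (toℕ i)
    b = toℕ k

proposition5p3 : (n : ℕ) .{{_ : NonZero n}} → 3 ≤ n →
    Σ (Matrix n) λ M →
    (∀ (i j : Fin n) → (Lmat n ⊗ M) i j ≡ scalarI (+ n) i j) ×
    (∀ (i j : Fin n) → (M ⊗ Lmat n) i j ≡ scalarI (+ n) i j) ×
    (∀ (i k : Fin n) → (+ n) ∣ (M i k - (+ toℕ k) * v₁ n i))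
proposition5p3 (suc zero) (ℕ.s≤s ())
proposition5p3 (suc (suc zero)) (ℕ.s≤s (ℕ.s≤s ()))
proposition5p3 (suc (suc (suc m))) _ =
  scaledInverse , Lmat-⊗-scaledInverse , scaledInverse-⊗-Lmat , scaledInverse-column
  where open Cycle m
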